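{- For every $N\in\mathbb{N}$ there exists $L\in\mathbb{N}$ and an integer $n\geq N$ such that $\Delta_\ell(n)<0$ for all integers $\ell\geq L$.
   Context: For integers $\ell\geq 1$ and $n\geq 1$, let $C_{\ell,n}=\{(\pi_1,\dots,\pi_\ell)\in S_n^\ell : \pi_j\pi_k=\pi_k\pi_j \text{ for all } j,k\}$, where $S_n$ is the symmetric group on $n$ letters, and $N_\ell(n)=|C_{\ell,n}|/n!$, with $N_\ell(0)=1$. Define $\Delta_\ell(n)=N_\ell(n)^2-N_\ell(n-1)N_\ell(n+1)$. -}

module Defs where

open import Data.Nat using (ℕ; zero; suc; _!; pred)
open import Data.Nat.Properties using (_!≢0)
open import Data.Fin using (Fin)
open import Data.Fin.Properties as FinP using (all?)
open import Data.List using (List; []; _∷_; length; filter; concatMap; map; allFin)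
open import Data.List.Relation.Unary.Unique.Propositional using (Unique)
open import Data.List.Relation.Unary.Unique.DecPropositional using (unique?)
open import Data.Vec using (Vec; []; _∷_; lookup; tabulate; toList)
open import Data.Vec.Properties using (≡-dec)
open import Data.Integer using (+_)
open import Data.Rational using (ℚ; _/_; _*_; _-_)
open import Relation.Binary.PropositionalEquality using (_≡_)
open import Relation.Nullary using (Dec)
open import Relation.Unary using (Decidable)

allVecs : ∀ {a} {A : Set a} (k : ℕ) → List A → List (Vec A k)
allVecs zero    xs = [] ∷ []
allVecs (suc k) xs = concatMap (λ x → map (x ∷_) (allVecs k xs)) xs

Map : ℕ → Set
Map n = Vec (Fin n) n

-- A map is a permutation iff it is injective (values pairwise distinct).
IsPerm : ∀ {n} → Map n → Set
IsPerm σ = Unique (toList σ)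

isPerm? : ∀ {n} → Decidable (IsPerm {n})
isPerm? σ = unique? FinP._≟_ (toList σ)

Sym : (n : ℕ) → List (Map n)
Sym n = filter isPerm? (allVecs n (allFin n))

_∘ₚ_ : ∀ {n} → Map n → Map n → Map n
σ ∘ₚ τ = tabulate (λ i → lookup σ (lookup τ i))

Commuting : ∀ {ℓ n} → Vec (Map n) ℓ → Set
Commuting π = ∀ j k → (lookup π j ∘ₚ lookup π k) ≡ (lookup π k ∘ₚ lookup π j)

commuting? : ∀ {ℓ n} → Decidable (Commuting {ℓ} {n})
commuting? π = all? (λ j → all? (λ k →
  ≡-dec FinP._≟_ (lookup π j ∘ₚ lookup π k) (lookup π k ∘ₚ lookup π j)))

C : (ℓ n : ℕ) → List (Vec (Map n) ℓ)
C ℓ n = filter commuting? (allVecs ℓ (Sym n))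

N : (ℓ n : ℕ) → ℚ
N ℓ zero    = + 1 / 1
N ℓ (suc n) = (+ length (C ℓ (suc n)) / (suc n !)) {{suc n !≢0}}

-- Δ_ℓ(n) = N_ℓ(n)^2 − N_ℓ(n−1) N_ℓ(n+1)   (meaningful for n ≥ 1).
Δ : (ℓ n : ℕ) → ℚ
Δ ℓ n = N ℓ n * N ℓ n - N ℓ (pred n) * N ℓ (suc n)

-- Write c(ℓ, n) = |C_{ℓ,n}|. A set S of pairwise commuting permutations of n points has at most
-- abelianBound n elements. Let O be the orbit of a point y₀ under S. Since it commutes with S, an
-- element of S is determined on O by its value at y₀, and it maps the complement of O to itself; so
-- the elements with a given value at y₀ are already told apart on the complement, and by induction
-- |S| ≤ |O| · abelianBound (n − |O|) ≤ abelianBound n. The entries of a tuple in C_{ℓ,n} form such a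
-- set, so c(ℓ, n) ≤ 2^{n!} · abelianBound(n)^ℓ. Conversely the regular actions of (ℤ/3)^k on 3k points
-- and of ℤ/2 × (ℤ/3)^k on 3k + 2 points give c(ℓ, 3k) ≥ 3^{kℓ} and c(ℓ, 3k + 2) ≥ (2 · 3^k)^ℓ. For
-- n = 3k + 1 we have abelianBound n = 4 · 3^{k−1}, and since 16 < 18 the inequality
-- N(n)² < N(n − 1) N(n + 1) holds as soon as ℓ is large.
module Submission where

open import Data.Bool using (Bool; true; false; T; _∧_; _∨_; not)
open import Data.Bool.Properties using (T-∨)
open import Data.Fin using (Fin; zero; suc; toℕ; splitAt; join; _↑ˡ_; _↑ʳ_; remQuot; combine)
import Data.Fin.Properties as Fin
open import Data.List using (List; []; _∷_; length; map; filter; concatMap; allFin; take; _++_; cartesianProductWith)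
import Data.List as List
import Data.List.Properties as List
open import Data.List.Membership.Propositional using (_∈_; find)
open import Data.List.Membership.Propositional.Properties
  using (∈-allFin; ∈-filter⁺; ∈-filter⁻; ∈-map⁺; ∈-map⁻; ∈-concatMap⁺; ∈-tabulate⁺; ∈-tabulate⁻;
         ∈-++⁺ˡ; ∈-++⁺ʳ; ∈-++⁻;
         ∈-cartesianProductWith⁺; ∈-cartesianProductWith⁻)
open import Data.List.Relation.Binary.Subset.Propositional using (_⊆_)
open import Data.List.Relation.Unary.Any as Any using (here; there)
open import Data.List.Relation.Unary.All as All using ([]; _∷_)
open import Data.List.Relation.Unary.AllPairs as AllPairs using (AllPairs; []; _∷_)
import Data.List.Relation.Unary.AllPairs.Properties as AllPairs
open import Data.List.Relation.Unary.Unique.Propositional using (Unique)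
import Data.List.Relation.Unary.Unique.Propositional.Properties as Unique
open import Data.Nat using (ℕ; zero; suc; _+_; _*_; _^_; _⊓_; _≤_; _<_; _≤?_; z≤n; s≤s; _!; NonZero)
open import Data.Nat.Properties
open import Data.Nat.Tactic.RingSolver using (solve-∀)
open import Algebra.Properties.CommutativeSemigroup *-commutativeSemigroup
  using () renaming (x∙yz≈y∙xz to x*yz≡y*xz; interchange to *-interchange)
open import Data.Product using (∃; ∃₂; _×_; _,_; proj₁; proj₂; uncurry)
open import Data.Sum using (_⊎_; inj₁; inj₂)
import Data.Sum as Sum
import Data.Sum.Properties as Sum
open import Data.Vec using (Vec; []; _∷_; lookup; tabulate; toList)
open import Data.Vec.Properties using (lookup∘tabulate; tabulate∘lookup; tabulate-cong; ≡-dec)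
import Data.Vec.Properties as Vec
open import Function using (_∘_; _$_; id)
open import Function.Bundles using (Equivalence)
open import Relation.Binary.PropositionalEquality
open import Relation.Nullary using (¬_; Dec; yes; no; does; contradiction)
open import Relation.Nullary.Decidable using (True; T?; ⌊_⌋; toWitness; fromWitness; _×-dec_; _→-dec_)
open import Data.Nat.DivMod using (_mod_)

open import Data.Integer as ℤ using (+_)
import Data.Integer.Properties as ℤ
open import Data.Rational as ℚ using (ℚ; 0ℚ; _/_)
import Data.Rational.Properties as ℚ
import Data.Rational.Unnormalised as ℚᵘ
import Data.Rational.Unnormalised.Properties as ℚᵘ

open import Defs

module _ {A : Set} where

  private
    remove : (ys : List A) {x : A} → x ∈ ys → List A
    remove (y ∷ ys) (here _)  = ys
    remove (y ∷ ys) (there p) = y ∷ remove ys p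

    length-remove : ∀ ys {x} (p : x ∈ ys) → length ys ≡ suc (length (remove ys p))
    length-remove (y ∷ ys) (here _)  = refl
    length-remove (y ∷ ys) (there p) = cong suc (length-remove ys p)

    ∈-remove : ∀ ys {x z} (p : x ∈ ys) → z ∈ ys → z ≢ x → z ∈ remove ys p
    ∈-remove (y ∷ ys) (here refl) (here refl) z≢x = contradiction refl z≢x
    ∈-remove (y ∷ ys) (here refl) (there q)   z≢x = q
    ∈-remove (y ∷ ys) (there p)   (here z≡y)  z≢x = here z≡y
    ∈-remove (y ∷ ys) (there p)   (there q)   z≢x = there (∈-remove ys p q z≢x)

  Unique-⊆⇒length≤ : ∀ {xs ys : List A} → Unique xs → xs ⊆ ys → length xs ≤ length ys
  Unique-⊆⇒length≤ {[]}              _           _       = z≤n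
  Unique-⊆⇒length≤ {x ∷ xs} {ys} (x∉xs ∷ u) x∷xs⊆ys = begin
    suc (length xs)                  ≤⟨ s≤s (Unique-⊆⇒length≤ u xs⊆ys-x) ⟩
    suc (length (remove ys x∈ys))    ≡⟨ length-remove ys x∈ys ⟨
    length ys                        ∎
    where
    open ≤-Reasoning
    x∈ys : x ∈ ys
    x∈ys = x∷xs⊆ys (here refl)
    xs⊆ys-x : xs ⊆ remove ys x∈ys
    xs⊆ys-x z∈xs = ∈-remove ys x∈ys (x∷xs⊆ys (there z∈xs)) (λ z≡x → All.lookup x∉xs z∈xs (sym z≡x))

  module _ {B : Set} (g : A → List B) where

    length-concatMap : ∀ {b} xs → (∀ x → length (g x) ≡ b) → length (concatMap g xs) ≡ length xs * b
    length-concatMap []       _ = refl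
    length-concatMap (x ∷ xs) h =
      trans (List.length-++ (g x)) (cong₂ _+_ (h x) (length-concatMap xs h))

    length-concatMap-≤ : ∀ {b} xs → (∀ x → length (g x) ≤ b) → length (concatMap g xs) ≤ length xs * b
    length-concatMap-≤ []       _ = z≤n
    length-concatMap-≤ (x ∷ xs) h =
      ≤-trans (≤-reflexive (List.length-++ (g x))) (+-mono-≤ (h x) (length-concatMap-≤ xs h))

  subsequences : List A → List (List A)
  subsequences []       = [] ∷ []
  subsequences (x ∷ xs) = map (x ∷_) (subsequences xs) ++ subsequences xs

  filter∈subsequences : ∀ {P : A → Set} (P? : ∀ x → Dec (P x)) xs → filter P? xs ∈ subsequences xs
  filter∈subsequences P? []       = here refl
  filter∈subsequences P? (x ∷ xs) with does (P? x)
  ... | true  = ∈-++⁺ˡ (∈-map⁺ (x ∷_) (filter∈subsequences P? xs))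
  ... | false = ∈-++⁺ʳ (map (x ∷_) (subsequences xs)) (filter∈subsequences P? xs)

  allVecs-suc : ∀ k (xs : List A) → allVecs (suc k) xs ≡ cartesianProductWith _∷_ xs (allVecs k xs)
  allVecs-suc k xs = prepend-each xs
    where
    prepend-each : ∀ ys → concatMap (λ y → map (y ∷_) (allVecs k xs)) ys
                        ≡ cartesianProductWith _∷_ ys (allVecs k xs)
    prepend-each []       = refl
    prepend-each (y ∷ ys) = cong (map (y ∷_) (allVecs k xs) ++_) (prepend-each ys)

  ∈-allVecs⁻ : ∀ {k} xs {v : Vec A k} → v ∈ allVecs k xs → ∀ i → lookup v i ∈ xs
  ∈-allVecs⁻ {suc k} xs v∈ i
    with _ , _ , y∈xs , w∈ , refl ← ∈-cartesianProductWith⁻ _∷_ xs (allVecs k xs)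
                                      (subst (_ ∈_) (allVecs-suc k xs) v∈)
    with i
  ... | zero  = y∈xs
  ... | suc i = ∈-allVecs⁻ xs w∈ i

  ∈-allVecs⁺ : ∀ {k} xs (v : Vec A k) → (∀ i → lookup v i ∈ xs) → v ∈ allVecs k xs
  ∈-allVecs⁺ xs []      _ = here refl
  ∈-allVecs⁺ {suc k} xs (x ∷ v) h = subst (_ ∈_) (sym (allVecs-suc k xs))
    (∈-cartesianProductWith⁺ _∷_ (h zero) (∈-allVecs⁺ xs v (h ∘ suc)))

  length-allVecs : ∀ k (xs : List A) → length (allVecs k xs) ≡ length xs ^ k
  length-allVecs zero    xs = refl
  length-allVecs (suc k) xs = length-concatMap (λ x → map (x ∷_) (allVecs k xs)) xs
    (λ x → trans (List.length-map (x ∷_) (allVecs k xs)) (length-allVecs k xs))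

  allVecs-Unique : ∀ k {xs : List A} → Unique xs → Unique (allVecs k xs)
  allVecs-Unique zero    _ = [] ∷ []
  allVecs-Unique (suc k) {xs} u = subst Unique (sym (allVecs-suc k xs))
    (Unique.cartesianProductWith⁺ _∷_ Vec.∷-injective u (allVecs-Unique k u))

  toList≡tabulate∘lookup : ∀ {k} (v : Vec A k) → toList v ≡ List.tabulate (lookup v)
  toList≡tabulate∘lookup []      = refl
  toList≡tabulate∘lookup (x ∷ v) = cong (x ∷_) (toList≡tabulate∘lookup v)

  lookup∈toList : ∀ {k} (v : Vec A k) i → lookup v i ∈ toList v
  lookup∈toList v i = subst (lookup v i ∈_) (sym (toList≡tabulate∘lookup v)) (∈-tabulate⁺ i)

  ∈toList⇒lookup : ∀ {k} (v : Vec A k) {x} → x ∈ toList v → ∃ λ i → x ≡ lookup v i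
  ∈toList⇒lookup v {x} x∈ = ∈-tabulate⁻ (subst (x ∈_) (toList≡tabulate∘lookup v) x∈)

  lookup-injective⇒Unique : ∀ {k} (v : Vec A k) → (∀ {i j} → lookup v i ≡ lookup v j → i ≡ j) →
                            Unique (toList v)
  lookup-injective⇒Unique v inj =
    subst Unique (sym (toList≡tabulate∘lookup v)) (Unique.tabulate⁺ inj)

  Unique⇒lookup-injective : ∀ {k} (v : Vec A k) → Unique (toList v) →
                            ∀ {i j} → lookup v i ≡ lookup v j → i ≡ j
  Unique⇒lookup-injective (x ∷ v) u          {zero}  {zero}  _ = refl
  Unique⇒lookup-injective (x ∷ v) (x∉v ∷ _) {zero}  {suc j} e =
    contradiction e (All.lookup x∉v (lookup∈toList v j))
  Unique⇒lookup-injective (x ∷ v) (x∉v ∷ _) {suc i} {zero}  e =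
    contradiction (sym e) (All.lookup x∉v (lookup∈toList v i))
  Unique⇒lookup-injective (x ∷ v) (_ ∷ u)   {suc i} {suc j} e = cong suc (Unique⇒lookup-injective v u e)

  lookup-extensionality : ∀ {k} (v w : Vec A k) → (∀ i → lookup v i ≡ lookup w i) → v ≡ w
  lookup-extensionality v w h = trans (sym (tabulate∘lookup v)) (trans (tabulate-cong h) (tabulate∘lookup w))

module _ {A : Set} {P : A → Set} {R R′ : A → A → Set} where

  AllPairs-map-All : (∀ {x y} → P x → P y → R x y → R′ x y) →
                     ∀ {xs} → All.All P xs → AllPairs R xs → AllPairs R′ xs
  AllPairs-map-All f []         []           = []
  AllPairs-map-All f (px ∷ pxs) (Rx ∷ Rxs) = All.zipWith (λ (py , Rxy) → f px py Rxy) (pxs , Rx)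
                                             ∷ AllPairs-map-All f pxs Rxs

-- The largest order of an abelian subgroup of S_n: 3^k, 4 · 3^(k−1) or 2 · 3^k for n = 3k, 3k + 1, 3k + 2.
abelianBound : ℕ → ℕ
abelianBound 0 = 1
abelianBound 1 = 1
abelianBound 2 = 2
abelianBound 3 = 3
abelianBound 4 = 4
abelianBound (suc (suc (suc (suc (suc n))))) = 3 * abelianBound (suc (suc n))

abelianBound-≤-suc : ∀ n → abelianBound n ≤ abelianBound (suc n)
abelianBound-≤-suc 0 = s≤s z≤n
abelianBound-≤-suc 1 = s≤s z≤n
abelianBound-≤-suc 2 = s≤s (s≤s z≤n)
abelianBound-≤-suc 3 = s≤s (s≤s (s≤s z≤n))
abelianBound-≤-suc 4 = s≤s (s≤s (s≤s (s≤s z≤n)))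
abelianBound-≤-suc (suc (suc (suc (suc (suc n))))) = *-monoʳ-≤ 3 (abelianBound-≤-suc (suc (suc n)))

abelianBound-mono : ∀ {m n} → m ≤ n → abelianBound m ≤ abelianBound n
abelianBound-mono {m} m≤n = go (≤⇒≤′ m≤n)
  where
  open Data.Nat using (_≤′_; ≤′-refl; ≤′-step)
  go : ∀ {n} → m ≤′ n → abelianBound m ≤ abelianBound n
  go ≤′-refl          = ≤-refl
  go (≤′-step {n} p) = ≤-trans (go p) (abelianBound-≤-suc n)

abelianBound-positive : ∀ n → 1 ≤ abelianBound n
abelianBound-positive n = abelianBound-mono {0} {n} z≤n

2*abelianBound≤ : ∀ n → 2 * abelianBound n ≤ abelianBound (2 + n)
2*abelianBound≤ 0 = ≤-refl
2*abelianBound≤ 1 = s≤s (s≤s z≤n)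
2*abelianBound≤ 2 = ≤-refl
2*abelianBound≤ 3 = ≤-refl
2*abelianBound≤ 4 = s≤s (s≤s (s≤s (s≤s (s≤s (s≤s (s≤s (s≤s z≤n)))))))
2*abelianBound≤ (suc (suc (suc (suc (suc n))))) = begin
  2 * (3 * abelianBound (2 + n)) ≡⟨ x*yz≡y*xz 2 3 (abelianBound (2 + n)) ⟩
  3 * (2 * abelianBound (2 + n)) ≤⟨ *-monoʳ-≤ 3 (2*abelianBound≤ (suc (suc n))) ⟩
  3 * abelianBound (4 + n)       ∎
  where open ≤-Reasoning

3*abelianBound≤ : ∀ n → 3 * abelianBound n ≤ abelianBound (3 + n)
3*abelianBound≤ 0 = ≤-refl
3*abelianBound≤ 1 = s≤s (s≤s (s≤s z≤n))
3*abelianBound≤ (suc (suc n)) = ≤-refl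

abelianBound-supermultiplicative : ∀ m n → abelianBound m * abelianBound n ≤ abelianBound (m + n)
abelianBound-supermultiplicative 0 n = ≤-reflexive (+-identityʳ (abelianBound n))
abelianBound-supermultiplicative 1 n = ≤-trans (≤-reflexive (+-identityʳ (abelianBound n))) (abelianBound-≤-suc n)
abelianBound-supermultiplicative 2 n = 2*abelianBound≤ n
abelianBound-supermultiplicative 3 n = 3*abelianBound≤ n
abelianBound-supermultiplicative 4 n = begin
  4 * abelianBound n       ≡⟨ *-assoc 2 2 (abelianBound n) ⟩
  2 * (2 * abelianBound n) ≤⟨ *-monoʳ-≤ 2 (2*abelianBound≤ n) ⟩
  2 * abelianBound (2 + n) ≤⟨ 2*abelianBound≤ (2 + n) ⟩
  abelianBound (4 + n)     ∎
  where open ≤-Reasoning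
abelianBound-supermultiplicative (suc (suc (suc (suc (suc m))))) n = begin
  3 * abelianBound (2 + m) * abelianBound n   ≡⟨ *-assoc 3 (abelianBound (2 + m)) (abelianBound n) ⟩
  3 * (abelianBound (2 + m) * abelianBound n) ≤⟨ *-monoʳ-≤ 3 (abelianBound-supermultiplicative (suc (suc m)) n) ⟩
  3 * abelianBound (2 + m + n)                ≤⟨ 3*abelianBound≤ (2 + m + n) ⟩
  abelianBound (5 + m + n)                    ∎
  where open ≤-Reasoning

n≤abelianBound : ∀ n → n ≤ abelianBound n
n≤abelianBound 0 = z≤n
n≤abelianBound 1 = ≤-refl
n≤abelianBound 2 = ≤-refl
n≤abelianBound 3 = ≤-refl
n≤abelianBound 4 = ≤-refl
n≤abelianBound (suc (suc (suc (suc (suc n))))) = begin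
  5 + n                    ≤⟨ +-monoʳ-≤ 5 (m≤n*m n 3) ⟩
  5 + 3 * n                ≤⟨ n≤1+n _ ⟩
  6 + 3 * n                ≡⟨ *-distribˡ-+ 3 2 n ⟨
  3 * (2 + n)              ≤⟨ *-monoʳ-≤ 3 (n≤abelianBound (suc (suc n))) ⟩
  3 * abelianBound (2 + n) ∎
  where open ≤-Reasoning

*abelianBound≤abelianBound+ : ∀ m n → m * abelianBound n ≤ abelianBound (m + n)
*abelianBound≤abelianBound+ m n =
  ≤-trans (*-monoˡ-≤ (abelianBound n) (n≤abelianBound m)) (abelianBound-supermultiplicative m n)

abelianBound-4+3k : ∀ k → abelianBound (4 + k * 3) ≡ 4 * 3 ^ k
abelianBound-4+3k zero    = refl
abelianBound-4+3k (suc k) = trans (cong (3 *_) (abelianBound-4+3k k)) (x*yz≡y*xz 3 4 (3 ^ k))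

Endo : ℕ → Set
Endo n = Fin n → Fin n

Subset : ℕ → Set
Subset n = Fin n → Bool

module _ {n : ℕ} where

  infix 4 _∈ₛ_ _⊆ₛ_

  _∈ₛ_ : Fin n → Subset n → Set
  x ∈ₛ U = T (U x)

  _⊆ₛ_ : Subset n → Subset n → Set
  U ⊆ₛ V = ∀ x → x ∈ₛ U → x ∈ₛ V

  _─ₛ_ : Subset n → Subset n → Subset n
  (U ─ₛ V) x = U x ∧ not (V x)

  ∈-─ₛ⁺ : ∀ U V {x} → x ∈ₛ U → ¬ x ∈ₛ V → x ∈ₛ U ─ₛ V
  ∈-─ₛ⁺ U V {x} x∈U x∉V with U x | V x
  ... | true | false = _
  ... | true | true  = x∉V _

  ∈-─ₛ⁻ : ∀ U V {x} → x ∈ₛ U ─ₛ V → x ∈ₛ U × ¬ x ∈ₛ V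
  ∈-─ₛ⁻ U V {x} x∈U─V with U x | V x
  ... | true | false = _ , λ ()

  elements : Subset n → List (Fin n)
  elements U = filter (λ x → T? (U x)) (allFin n)

  ∣_∣ : Subset n → ℕ
  ∣ U ∣ = length (elements U)

  ∈-elements⁺ : ∀ U {x} → x ∈ₛ U → x ∈ elements U
  ∈-elements⁺ U {x} = ∈-filter⁺ (λ x → T? (U x)) (∈-allFin x)

  ∈-elements⁻ : ∀ U {x} → x ∈ elements U → x ∈ₛ U
  ∈-elements⁻ U = proj₂ ∘ ∈-filter⁻ (λ x → T? (U x)) {xs = allFin n}

  elements-Unique : ∀ U → Unique (elements U)
  elements-Unique U = Unique.filter⁺ (λ x → T? (U x)) (Unique.allFin⁺ n)

  ∉ₛ⇒∷elements-Unique : ∀ U {x} → ¬ x ∈ₛ U → Unique (x ∷ elements U)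
  ∉ₛ⇒∷elements-Unique U x∉U = All.tabulate (λ { y∈U refl → x∉U (∈-elements⁻ U y∈U) }) ∷ elements-Unique U

  ∣U∣≤n : ∀ U → ∣ U ∣ ≤ n
  ∣U∣≤n U = ≤-trans (List.length-filter (λ x → T? (U x)) (allFin n)) (≤-reflexive (List.length-tabulate id))

  ∈ₛ⇒∣U∣>0 : ∀ U {x} → x ∈ₛ U → 0 < ∣ U ∣
  ∈ₛ⇒∣U∣>0 U x∈U = Unique-⊆⇒length≤ ([] ∷ []) λ { (here refl) → ∈-elements⁺ U x∈U }

  ⊂ₛ⇒∣∣< : ∀ U V {x} → U ⊆ₛ V → x ∈ₛ V → ¬ x ∈ₛ U → ∣ U ∣ < ∣ V ∣
  ⊂ₛ⇒∣∣< U V U⊆V x∈V x∉U = Unique-⊆⇒length≤ (∉ₛ⇒∷elements-Unique U x∉U) x∷U⊆V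
    where
    x∷U⊆V : _ ∷ elements U ⊆ elements V
    x∷U⊆V (here refl)  = ∈-elements⁺ V x∈V
    x∷U⊆V (there y∈U) = ∈-elements⁺ V (U⊆V _ (∈-elements⁻ U y∈U))

  ⊆ₛ∧∣∣≥⇒⊇ₛ : ∀ U V → U ⊆ₛ V → ∣ V ∣ ≤ ∣ U ∣ → V ⊆ₛ U
  ⊆ₛ∧∣∣≥⇒⊇ₛ U V U⊆V ∣V∣≤∣U∣ x x∈V with T? (U x)
  ... | yes x∈U = x∈U
  ... | no  x∉U = contradiction ∣V∣≤∣U∣ (<⇒≱ (⊂ₛ⇒∣∣< U V U⊆V x∈V x∉U))

  ∣─ₛ∣+∣∣≤∣∣ : ∀ U V → V ⊆ₛ U → ∣ U ─ₛ V ∣ + ∣ V ∣ ≤ ∣ U ∣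
  ∣─ₛ∣+∣∣≤∣∣ U V V⊆U = begin
    ∣ U ─ₛ V ∣ + ∣ V ∣                  ≡⟨ List.length-++ (elements (U ─ₛ V)) ⟨
    length (elements (U ─ₛ V) ++ elements V) ≤⟨ Unique-⊆⇒length≤ unique ⊆U ⟩
    ∣ U ∣                               ∎
    where
    open ≤-Reasoning
    unique : Unique (elements (U ─ₛ V) ++ elements V)
    unique = Unique.++⁺ (elements-Unique (U ─ₛ V)) (elements-Unique V)
      λ (x∈U─V , x∈V) → proj₂ (∈-─ₛ⁻ U V (∈-elements⁻ (U ─ₛ V) x∈U─V)) (∈-elements⁻ V x∈V)
    ⊆U : elements (U ─ₛ V) ++ elements V ⊆ elements U
    ⊆U x∈ with ∈-++⁻ (elements (U ─ₛ V)) x∈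
    ... | inj₁ x∈U─V = ∈-elements⁺ U (proj₁ (∈-─ₛ⁻ U V (∈-elements⁻ (U ─ₛ V) x∈U─V)))
    ... | inj₂ x∈V   = ∈-elements⁺ U (V⊆U _ (∈-elements⁻ V x∈V))

module Orbit {n : ℕ} (S : List (Endo n)) (y₀ : Fin n) where

  Closed : Subset n → Set
  Closed U = ∀ {σ} → σ ∈ S → ∀ x → x ∈ₛ U → σ x ∈ₛ U

  reaches? : ∀ U y → Dec (Any.Any (λ σ → ∃ λ x → x ∈ₛ U × σ x ≡ y) S)
  reaches? U y = Any.any? (λ σ → Fin.any? (λ x → T? (U x) ×-dec σ x Fin.≟ y)) S

  step : Subset n → Subset n
  step U y = U y ∨ ⌊ reaches? U y ⌋

  step-⊇ : ∀ U → U ⊆ₛ step U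
  step-⊇ U x x∈U = Equivalence.from T-∨ (inj₁ x∈U)

  step-image : ∀ U {σ} → σ ∈ S → ∀ x → x ∈ₛ U → σ x ∈ₛ step U
  step-image U σ∈S x x∈U =
    Equivalence.from T-∨ (inj₂ (fromWitness {a? = reaches? U _} (Any.map (λ { refl → x , x∈U , refl }) σ∈S)))

  step-elim : ∀ U y → y ∈ₛ step U → y ∈ₛ U ⊎ ∃₂ λ σ x → σ ∈ S × x ∈ₛ U × σ x ≡ y
  step-elim U y y∈ with Equivalence.to T-∨ y∈
  ... | inj₁ y∈U = inj₁ y∈U
  ... | inj₂ w with σ , σ∈S , x , x∈U , σx≡y ← find (toWitness {a? = reaches? U y} w) =
    inj₂ (σ , x , σ∈S , x∈U , σx≡y)

  step-closed : ∀ U → Closed U → Closed (step U)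
  step-closed U U-closed σ∈S x x∈ with step-elim U x x∈
  ... | inj₁ x∈U                        = step-⊇ U _ (U-closed σ∈S x x∈U)
  ... | inj₂ (ρ , z , ρ∈S , z∈U , refl) = step-⊇ U _ (U-closed σ∈S _ (U-closed ρ∈S z z∈U))

  step-⊆⇒closed : ∀ U → step U ⊆ₛ U → Closed U
  step-⊆⇒closed U step⊆U σ∈S x x∈U = step⊆U _ (step-image U σ∈S x x∈U)

  approx : ℕ → Subset n
  approx zero    y = ⌊ y Fin.≟ y₀ ⌋
  approx (suc i)   = step (approx i)

  y₀∈approx : ∀ i → y₀ ∈ₛ approx i
  y₀∈approx zero    = fromWitness refl
  y₀∈approx (suc i) = step-⊇ (approx i) y₀ (y₀∈approx i)

  approx-induction : (P : Fin n → Set) → P y₀ → (∀ {σ} → σ ∈ S → ∀ x → P x → P (σ x)) →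
                     ∀ i y → y ∈ₛ approx i → P y
  approx-induction P Py₀ P-step zero y y∈ = subst P (sym (toWitness {a? = y Fin.≟ y₀} y∈)) Py₀
  approx-induction P Py₀ P-step (suc i) y y∈ with step-elim (approx i) y y∈
  ... | inj₁ y∈′                         = approx-induction P Py₀ P-step i y y∈′
  ... | inj₂ (σ , x , σ∈S , x∈ , refl) = P-step σ∈S x (approx-induction P Py₀ P-step i x x∈)

  grows-or-closed : ∀ i → i < ∣ approx i ∣ ⊎ Closed (approx i)
  grows-or-closed zero = inj₁ (∈ₛ⇒∣U∣>0 (approx 0) (y₀∈approx 0))
  grows-or-closed (suc i) with grows-or-closed i
  ... | inj₂ closed = inj₂ (step-closed (approx i) closed)
  ... | inj₁ grows with ∣ approx (suc i) ∣ ≤? ∣ approx i ∣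
  ...   | yes no-growth = inj₂ (step-closed (approx i) (step-⊆⇒closed (approx i)
                            (⊆ₛ∧∣∣≥⇒⊇ₛ (approx i) (approx (suc i)) (step-⊇ (approx i)) no-growth)))
  ...   | no  growth    = inj₁ (≤-trans (s≤s grows) (≰⇒> growth))

  orbit : Subset n
  orbit = approx n

  y₀∈orbit : y₀ ∈ₛ orbit
  y₀∈orbit = y₀∈approx n

  orbit-closed : Closed orbit
  orbit-closed with grows-or-closed n
  ... | inj₁ n<∣orbit∣ = contradiction (∣U∣≤n orbit) (<⇒≱ n<∣orbit∣)
  ... | inj₂ closed    = closed

  orbit-induction : (P : Fin n → Set) → P y₀ → (∀ {σ} → σ ∈ S → ∀ x → P x → P (σ x)) →
                    ∀ y → y ∈ₛ orbit → P y
  orbit-induction P Py₀ P-step = approx-induction P Py₀ P-step n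

  orbit-minimal : ∀ U → y₀ ∈ₛ U → Closed U → orbit ⊆ₛ U
  orbit-minimal U y₀∈U U-closed = orbit-induction (_∈ₛ U) y₀∈U U-closed

  orbit-determined : ∀ (σ τ : Endo n) →
                     (∀ {ρ} → ρ ∈ S → ∀ x → σ (ρ x) ≡ ρ (σ x)) →
                     (∀ {ρ} → ρ ∈ S → ∀ x → τ (ρ x) ≡ ρ (τ x)) →
                     σ y₀ ≡ τ y₀ → ∀ y → y ∈ₛ orbit → σ y ≡ τ y
  orbit-determined σ τ σ-comm τ-comm σy₀≡τy₀ = orbit-induction (λ y → σ y ≡ τ y) σy₀≡τy₀
    λ {ρ} ρ∈S x σx≡τx → trans (σ-comm ρ∈S x) (trans (cong ρ σx≡τx) (sym (τ-comm ρ∈S x)))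

  complement-closed : ∀ {σ} → σ ∈ S → (∀ {x y} → σ x ≡ σ y → x ≡ y) →
                      ∀ y → ¬ y ∈ₛ orbit → ¬ σ y ∈ₛ orbit
  -- σ maps the orbit injectively into itself, hence onto it, so no point outside is sent inside.
  complement-closed {σ} σ∈S σ-injective y y∉O σy∈O = <-irrefl refl (begin-strict
    ∣ orbit ∣                                   <⟨ n<1+n _ ⟩
    length (y ∷ elements orbit)                 ≡⟨ List.length-map σ (y ∷ elements orbit) ⟨
    length (map σ (y ∷ elements orbit))         ≤⟨ Unique-⊆⇒length≤ unique image⊆orbit ⟩
    ∣ orbit ∣                                   ∎)
    where
    open ≤-Reasoning
    unique : Unique (map σ (y ∷ elements orbit))
    unique = Unique.map⁺ σ-injective (∉ₛ⇒∷elements-Unique orbit y∉O)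
    image⊆orbit : map σ (y ∷ elements orbit) ⊆ elements orbit
    image⊆orbit (here refl)  = ∈-elements⁺ orbit σy∈O
    image⊆orbit (there z∈) with x , x∈O , refl ← ∈-map⁻ σ z∈ =
      ∈-elements⁺ orbit (orbit-closed σ∈S x (∈-elements⁻ orbit x∈O))

AgreeOn : ∀ {n} → Subset n → Endo n → Endo n → Set
AgreeOn Y σ τ = ∀ y → y ∈ₛ Y → σ y ≡ τ y

record CommutingOn {n : ℕ} (Y : Subset n) (S : List (Endo n)) : Set where
  field
    injective : ∀ {σ} → σ ∈ S → ∀ {x y} → σ x ≡ σ y → x ≡ y
    commute   : ∀ {σ τ} → σ ∈ S → τ ∈ S → ∀ x → σ (τ x) ≡ τ (σ x)
    preserves : ∀ {σ} → σ ∈ S → ∀ x → x ∈ₛ Y → σ x ∈ₛ Y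
    distinct  : AllPairs (λ σ τ → ¬ AgreeOn Y σ τ) S

module OrbitFibres {n : ℕ} {Y : Subset n} {S : List (Endo n)} (S-comm : CommutingOn Y S)
                   {y₀ : Fin n} (y₀∈Y : y₀ ∈ₛ Y) where

  open CommutingOn S-comm
  open Orbit S y₀ public using (orbit)
  open Orbit S y₀ hiding (orbit)

  fibre : Fin n → List (Endo n)
  fibre v = filter (λ σ → σ y₀ Fin.≟ v) S

  ∈-fibre⁻ : ∀ {v σ} → σ ∈ fibre v → σ ∈ S × σ y₀ ≡ v
  ∈-fibre⁻ {v} = ∈-filter⁻ (λ σ → σ y₀ Fin.≟ v) {xs = S}

  fibre-commutingOn : ∀ v → CommutingOn (Y ─ₛ orbit) (fibre v)
  fibre-commutingOn v = record
    { injective = injective ∘ proj₁ ∘ ∈-fibre⁻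
    ; commute   = λ σ∈ τ∈ → commute (proj₁ (∈-fibre⁻ σ∈)) (proj₁ (∈-fibre⁻ τ∈))
    ; preserves = preserves′
    ; distinct  = AllPairs-map-All disagree (All.tabulate ∈-fibre⁻)
                    (AllPairs.filter⁺ (λ σ → σ y₀ Fin.≟ v) distinct)
    }
    where
    preserves′ : ∀ {σ} → σ ∈ fibre v → ∀ x → x ∈ₛ Y ─ₛ orbit → σ x ∈ₛ Y ─ₛ orbit
    preserves′ σ∈ x x∈ = let σ∈S = proj₁ (∈-fibre⁻ σ∈) ; x∈Y , x∉O = ∈-─ₛ⁻ Y orbit x∈ in
      ∈-─ₛ⁺ Y orbit (preserves σ∈S x x∈Y) (complement-closed σ∈S (injective σ∈S) x x∉O)
    disagree : ∀ {σ τ} → σ ∈ S × σ y₀ ≡ v → τ ∈ S × τ y₀ ≡ v →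
               ¬ AgreeOn Y σ τ → ¬ AgreeOn (Y ─ₛ orbit) σ τ
    disagree {σ} {τ} (σ∈S , σy₀≡v) (τ∈S , τy₀≡v) ¬agree agree─ = ¬agree agreeOnY
      where
      agreeOnY : AgreeOn Y σ τ
      agreeOnY y y∈Y with T? (orbit y)
      ... | yes y∈O = orbit-determined σ τ (commute σ∈S) (commute τ∈S) (trans σy₀≡v (sym τy₀≡v)) y y∈O
      ... | no  y∉O = agree─ y (∈-─ₛ⁺ Y orbit y∈Y y∉O)

  length≤∣orbit∣* : ∀ {b} → (∀ v → length (fibre v) ≤ b) → length S ≤ ∣ orbit ∣ * b
  length≤∣orbit∣* fibre≤b =
    ≤-trans (Unique-⊆⇒length≤ S-Unique S⊆fibres) (length-concatMap-≤ fibre (elements orbit) fibre≤b)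
    where
    S-Unique : Unique S
    S-Unique = AllPairs.map (λ ¬agree σ≡τ → ¬agree λ y _ → cong (_$ y) σ≡τ) distinct
    S⊆fibres : S ⊆ concatMap fibre (elements orbit)
    S⊆fibres {σ} σ∈S = ∈-concatMap⁺ fibre (Any.map (λ { refl → ∈-filter⁺ (λ σ → σ y₀ Fin.≟ _) σ∈S refl })
      (∈-elements⁺ orbit (orbit-closed σ∈S y₀ y₀∈orbit)))

  ∣Y─orbit∣+∣orbit∣≤∣Y∣ : ∣ Y ─ₛ orbit ∣ + ∣ orbit ∣ ≤ ∣ Y ∣
  ∣Y─orbit∣+∣orbit∣≤∣Y∣ = ∣─ₛ∣+∣∣≤∣∣ Y orbit (orbit-minimal Y y₀∈Y preserves)

  ∣Y─orbit∣<∣Y∣ : ∣ Y ─ₛ orbit ∣ < ∣ Y ∣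
  ∣Y─orbit∣<∣Y∣ = <-≤-trans (m<m+n _ (∈ₛ⇒∣U∣>0 orbit y₀∈orbit)) ∣Y─orbit∣+∣orbit∣≤∣Y∣

commutingOn-length≤abelianBound : ∀ {n} (Y : Subset n) S → CommutingOn Y S → length S ≤ abelianBound ∣ Y ∣
commutingOn-length≤abelianBound Y S = bounded ∣ Y ∣ Y S ≤-refl
  where
  -- k bounds the recursion depth: each recursive call removes a nonempty orbit from Y.
  bounded : ∀ {n} k (Y : Subset n) S → ∣ Y ∣ ≤ k → CommutingOn Y S → length S ≤ abelianBound ∣ Y ∣
  bounded k Y S ∣Y∣≤k S-comm with Fin.any? (λ y → T? (Y y))
  bounded k Y S ∣Y∣≤k S-comm | no Y-empty =
    ≤-trans (length≤1 (CommutingOn.distinct S-comm)) (abelianBound-positive ∣ Y ∣)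
    where
    length≤1 : ∀ {S} → AllPairs (λ σ τ → ¬ AgreeOn Y σ τ) S → length S ≤ 1
    length≤1 []                   = z≤n
    length≤1 (_ ∷ [])             = s≤s z≤n
    length≤1 ((¬agree ∷ _) ∷ _) = contradiction (λ y y∈Y → contradiction (y , y∈Y) Y-empty) ¬agree
  bounded zero Y S ∣Y∣≤0 S-comm | yes (y₀ , y₀∈Y) = contradiction ∣Y∣≤0 (<⇒≱ (∈ₛ⇒∣U∣>0 Y y₀∈Y))
  bounded (suc k) Y S ∣Y∣≤1+k S-comm | yes (y₀ , y₀∈Y) = begin
    length S                                          ≤⟨ length≤∣orbit∣* fibre≤ ⟩
    ∣ orbit ∣ * abelianBound ∣ Y ─ₛ orbit ∣           ≤⟨ *abelianBound≤abelianBound+ ∣ orbit ∣ _ ⟩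
    abelianBound (∣ orbit ∣ + ∣ Y ─ₛ orbit ∣)         ≤⟨ abelianBound-mono ∣orbit∣+∣Y─orbit∣≤∣Y∣ ⟩
    abelianBound ∣ Y ∣                                ∎
    where
    open ≤-Reasoning
    open OrbitFibres S-comm y₀∈Y
    fibre≤ : ∀ v → length (fibre v) ≤ abelianBound ∣ Y ─ₛ orbit ∣
    fibre≤ v = bounded k (Y ─ₛ orbit) (fibre v) (≤-pred (<-≤-trans ∣Y─orbit∣<∣Y∣ ∣Y∣≤1+k))
                         (fibre-commutingOn v)
    ∣orbit∣+∣Y─orbit∣≤∣Y∣ : ∣ orbit ∣ + ∣ Y ─ₛ orbit ∣ ≤ ∣ Y ∣
    ∣orbit∣+∣Y─orbit∣≤∣Y∣ = ≤-trans (≤-reflexive (+-comm ∣ orbit ∣ _)) ∣Y─orbit∣+∣orbit∣≤∣Y∣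

module _ {n : ℕ} where

  private
    everything : Subset n
    everything _ = true

    ∣everything∣≡n : ∣ everything ∣ ≡ n
    ∣everything∣≡n =
      trans (cong length (List.filter-all (λ x → T? (everything x)) {xs = allFin n} (All.tabulate (λ _ → _))))
                           (List.length-tabulate id)

  commuting-permutations-length≤ : ∀ (P : List (Map n)) → Unique P → (∀ {σ} → σ ∈ P → IsPerm σ) →
                                   (∀ {σ τ} → σ ∈ P → τ ∈ P → σ ∘ₚ τ ≡ τ ∘ₚ σ) →
                                   length P ≤ abelianBound n
  commuting-permutations-length≤ P P-unique P-perm P-comm = begin
    length P                       ≡⟨ List.length-map lookup P ⟨
    length (map lookup P)          ≤⟨ commutingOn-length≤abelianBound everything (map lookup P) commutingOn ⟩
    abelianBound ∣ everything ∣    ≡⟨ cong abelianBound ∣everything∣≡n ⟩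
    abelianBound n                 ∎
    where
    open ≤-Reasoning
    commutingOn : CommutingOn everything (map lookup P)
    commutingOn = record
      { injective = λ σ∈ → let σ , σ∈P , eq = ∈-map⁻ lookup σ∈ in
          subst (λ f → ∀ {x y} → f x ≡ f y → x ≡ y) (sym eq) (Unique⇒lookup-injective σ (P-perm σ∈P))
      ; commute   = commute
      ; preserves = λ _ _ _ → _
      ; distinct  = AllPairs.map⁺ (AllPairs.map
                      (λ σ≢τ agree → σ≢τ (lookup-extensionality _ _ (λ i → agree i _))) P-unique)
      }
      where
      commute : ∀ {f g} → f ∈ map lookup P → g ∈ map lookup P → ∀ x → f (g x) ≡ g (f x)
      commute f∈ g∈ x with σ , σ∈P , refl ← ∈-map⁻ lookup f∈ | τ , τ∈P , refl ← ∈-map⁻ lookup g∈ =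
        trans (sym (lookup∘tabulate _ x))
              (trans (cong (λ ρ → lookup ρ x) (P-comm σ∈P τ∈P)) (lookup∘tabulate _ x))

length-C≤ : ∀ ℓ n → length (C ℓ n) ≤ length (subsequences (Sym n)) * abelianBound n ^ ℓ
length-C≤ ℓ n = ≤-trans (Unique-⊆⇒length≤ C-Unique C⊆tuples)
                        (length-concatMap-≤ tuples (subsequences (Sym n)) length-tuples)
  where
  -- Truncation changes nothing for the commuting entry sets that occur, and bounds every term uniformly.
  tuples : List (Map n) → List (Vec (Map n) ℓ)
  tuples P = allVecs ℓ (take (abelianBound n) P)

  length-tuples : ∀ P → length (tuples P) ≤ abelianBound n ^ ℓ
  length-tuples P = begin
    length (tuples P)                        ≡⟨ length-allVecs ℓ (take (abelianBound n) P) ⟩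
    length (take (abelianBound n) P) ^ ℓ     ≡⟨ cong (_^ ℓ) (List.length-take (abelianBound n) P) ⟩
    (abelianBound n ⊓ length P) ^ ℓ          ≤⟨ ^-monoˡ-≤ ℓ (m⊓n≤m (abelianBound n) (length P)) ⟩
    abelianBound n ^ ℓ                       ∎
    where open ≤-Reasoning

  Sym-Unique : Unique (Sym n)
  Sym-Unique = Unique.filter⁺ isPerm? (allVecs-Unique n (Unique.allFin⁺ n))

  C-Unique : Unique (C ℓ n)
  C-Unique = Unique.filter⁺ commuting? (allVecs-Unique ℓ Sym-Unique)

  C⊆tuples : C ℓ n ⊆ concatMap tuples (subsequences (Sym n))
  C⊆tuples {t} t∈C = ∈-concatMap⁺ tuples (Any.map (λ { refl → t∈tuples }) (filter∈subsequences entry? (Sym n)))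
    where
    t∈Sym^ℓ : t ∈ allVecs ℓ (Sym n)
    t∈Sym^ℓ = proj₁ (∈-filter⁻ commuting? {xs = allVecs ℓ (Sym n)} t∈C)
    t-commuting : Commuting t
    t-commuting = proj₂ (∈-filter⁻ commuting? {xs = allVecs ℓ (Sym n)} t∈C)
    entry? : ∀ σ → Dec (σ ∈ toList t)
    entry? σ = Any.any? (≡-dec Fin._≟_ σ) (toList t)
    entries : List (Map n)
    entries = filter entry? (Sym n)
    ∈-entries⁻ : ∀ {σ} → σ ∈ entries → σ ∈ Sym n × σ ∈ toList t
    ∈-entries⁻ = ∈-filter⁻ entry? {xs = Sym n}
    entries-commute : ∀ {σ τ} → σ ∈ entries → τ ∈ entries → σ ∘ₚ τ ≡ τ ∘ₚ σ
    entries-commute σ∈ τ∈ with j , refl ← ∈toList⇒lookup t (proj₂ (∈-entries⁻ σ∈))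
                             | k , refl ← ∈toList⇒lookup t (proj₂ (∈-entries⁻ τ∈)) = t-commuting j k
    length-entries : length entries ≤ abelianBound n
    length-entries = commuting-permutations-length≤ entries (Unique.filter⁺ entry? Sym-Unique)
      (λ σ∈ → proj₂ (∈-filter⁻ isPerm? {xs = allVecs n (allFin n)} (proj₁ (∈-entries⁻ σ∈)))) entries-commute
    t∈tuples : t ∈ tuples entries
    t∈tuples rewrite List.take-all (abelianBound n) entries length-entries =
      ∈-allVecs⁺ entries t λ i → ∈-filter⁺ entry? (∈-allVecs⁻ (Sym n) t∈Sym^ℓ i) (lookup∈toList t i)

record CommutingFamily (a c : ℕ) : Set where
  field
    act       : Fin c → Endo a
    injective : ∀ i x y → act i x ≡ act i y → x ≡ y
    faithful  : ∀ i j → (∀ x → act i x ≡ act j x) → i ≡ j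
    commute   : ∀ i j x → act i (act j x) ≡ act j (act i x)

isCommutingFamily? : ∀ {a c} (act : Fin c → Endo a) →
                     Dec ((∀ i x y → act i x ≡ act i y → x ≡ y) ×
                          (∀ i j → (∀ x → act i x ≡ act j x) → i ≡ j) ×
                          (∀ i j x → act i (act j x) ≡ act j (act i x)))
isCommutingFamily? act =
  Fin.all? (λ i → Fin.all? λ x → Fin.all? λ y → act i x Fin.≟ act i y →-dec x Fin.≟ y) ×-dec
  Fin.all? (λ i → Fin.all? λ j → Fin.all? (λ x → act i x Fin.≟ act j x) →-dec i Fin.≟ j) ×-dec
  Fin.all? (λ i → Fin.all? λ j → Fin.all? λ x → act i (act j x) Fin.≟ act j (act i x))

byDecision : ∀ {a c} (act : Fin c → Endo a) → {True (isCommutingFamily? act)} → CommutingFamily a c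
byDecision act {ok} = let injective , faithful , commute = toWitness ok in
  record { act = act ; injective = injective ; faithful = faithful ; commute = commute }

rotations : ∀ k .{{_ : NonZero k}} → Fin k → Endo k
rotations k i x = (toℕ i + toℕ x) mod k

trivialFamily : CommutingFamily 0 1
trivialFamily = byDecision (λ _ x → x)

cyclic₂ : CommutingFamily 2 2
cyclic₂ = byDecision (rotations 2)

cyclic₃ : CommutingFamily 3 3
cyclic₃ = byDecision (rotations 3)

module _ {a b c d : ℕ} (F : CommutingFamily a c) (G : CommutingFamily b d) where

  private
    module F = CommutingFamily F
    module G = CommutingFamily G

    pairAct : Fin c → Fin d → Endo (a + b)
    pairAct i j = join a b ∘ Sum.map (F.act i) (G.act j) ∘ splitAt a

    splitAt-pairAct : ∀ i j z → splitAt a (pairAct i j z) ≡ Sum.map (F.act i) (G.act j) (splitAt a z)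
    splitAt-pairAct i j z = Fin.splitAt-join a b _

    pairAct-↑ˡ : ∀ i j x → pairAct i j (x ↑ˡ b) ≡ F.act i x ↑ˡ b
    pairAct-↑ˡ i j x = cong (join a b ∘ Sum.map (F.act i) (G.act j)) (Fin.splitAt-↑ˡ a x b)

    pairAct-↑ʳ : ∀ i j y → pairAct i j (a ↑ʳ y) ≡ a ↑ʳ G.act j y
    pairAct-↑ʳ i j y = cong (join a b ∘ Sum.map (F.act i) (G.act j)) (Fin.splitAt-↑ʳ a b y)

    map-injective : ∀ i j u v → Sum.map (F.act i) (G.act j) u ≡ Sum.map (F.act i) (G.act j) v → u ≡ v
    map-injective i j (inj₁ x) (inj₁ y) eq = cong inj₁ (F.injective i x y (Sum.inj₁-injective eq))
    map-injective i j (inj₂ x) (inj₂ y) eq = cong inj₂ (G.injective j x y (Sum.inj₂-injective eq))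

    map-commute : ∀ i j i′ j′ u → Sum.map (F.act i) (G.act j) (Sum.map (F.act i′) (G.act j′) u)
                                ≡ Sum.map (F.act i′) (G.act j′) (Sum.map (F.act i) (G.act j) u)
    map-commute i j i′ j′ (inj₁ x) = cong inj₁ (F.commute i i′ x)
    map-commute i j i′ j′ (inj₂ y) = cong inj₂ (G.commute j j′ y)

    pairAct-injective : ∀ i j x y → pairAct i j x ≡ pairAct i j y → x ≡ y
    pairAct-injective i j x y eq = begin
      x                    ≡⟨ Fin.join-splitAt a b x ⟨
      join a b (splitAt a x) ≡⟨ cong (join a b) (map-injective i j (splitAt a x) (splitAt a y) (begin
        Sum.map (F.act i) (G.act j) (splitAt a x) ≡⟨ splitAt-pairAct i j x ⟨
        splitAt a (pairAct i j x)                 ≡⟨ cong (splitAt a) eq ⟩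
        splitAt a (pairAct i j y)                 ≡⟨ splitAt-pairAct i j y ⟩
        Sum.map (F.act i) (G.act j) (splitAt a y) ∎)) ⟩
      join a b (splitAt a y) ≡⟨ Fin.join-splitAt a b y ⟩
      y                    ∎
      where open ≡-Reasoning

    pairAct-commute : ∀ i j i′ j′ z → pairAct i j (pairAct i′ j′ z) ≡ pairAct i′ j′ (pairAct i j z)
    pairAct-commute i j i′ j′ z = cong (join a b) (begin
      Sum.map (F.act i) (G.act j) (splitAt a (pairAct i′ j′ z))
        ≡⟨ cong (Sum.map (F.act i) (G.act j)) (splitAt-pairAct i′ j′ z) ⟩
      Sum.map (F.act i) (G.act j) (Sum.map (F.act i′) (G.act j′) (splitAt a z))
        ≡⟨ map-commute i j i′ j′ (splitAt a z) ⟩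
      Sum.map (F.act i′) (G.act j′) (Sum.map (F.act i) (G.act j) (splitAt a z))
        ≡⟨ cong (Sum.map (F.act i′) (G.act j′)) (splitAt-pairAct i j z) ⟨
      Sum.map (F.act i′) (G.act j′) (splitAt a (pairAct i j z)) ∎)
      where open ≡-Reasoning

    pairAct-faithful : ∀ i j i′ j′ → (∀ z → pairAct i j z ≡ pairAct i′ j′ z) → (i , j) ≡ (i′ , j′)
    pairAct-faithful i j i′ j′ same = cong₂ _,_
      (F.faithful i i′ (λ x → Fin.↑ˡ-injective b _ _
        (trans (sym (pairAct-↑ˡ i j x)) (trans (same (x ↑ˡ b)) (pairAct-↑ˡ i′ j′ x)))))
      (G.faithful j j′ (λ y → Fin.↑ʳ-injective a _ _
        (trans (sym (pairAct-↑ʳ i j y)) (trans (same (a ↑ʳ y)) (pairAct-↑ʳ i′ j′ y)))))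

  infixr 6 _⊗_
  _⊗_ : CommutingFamily (a + b) (c * d)
  _⊗_ = record
    { act       = λ k → uncurry pairAct (remQuot {c} d k)
    ; injective = λ k → uncurry pairAct-injective (remQuot {c} d k)
    ; faithful  = faithful
    ; commute   = λ k k′ → uncurry (uncurry pairAct-commute (remQuot {c} d k)) (remQuot {c} d k′)
    }
    where
    faithful : ∀ k k′ → (∀ z → uncurry pairAct (remQuot {c} d k) z ≡ uncurry pairAct (remQuot d k′) z) → k ≡ k′
    faithful k k′ same = begin
      k                                  ≡⟨ Fin.combine-remQuot {c} d k ⟨
      uncurry combine (remQuot {c} d k)  ≡⟨ cong (uncurry combine) remQuot≡ ⟩
      uncurry combine (remQuot {c} d k′) ≡⟨ Fin.combine-remQuot {c} d k′ ⟩
      k′                                 ∎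
      where
      open ≡-Reasoning
      remQuot≡ : remQuot {c} d k ≡ remQuot d k′
      remQuot≡ = uncurry (uncurry pairAct-faithful (remQuot {c} d k)) (remQuot d k′) same

_^⊗_ : ∀ {a c} → CommutingFamily a c → ∀ j → CommutingFamily (j * a) (c ^ j)
F ^⊗ zero  = trivialFamily
F ^⊗ suc j = F ⊗ F ^⊗ j

module _ {m c : ℕ} (F : CommutingFamily m c) where

  open CommutingFamily F

  asPerm : Fin c → Map m
  asPerm i = tabulate (act i)

  asPerm-injective : ∀ {i j} → asPerm i ≡ asPerm j → i ≡ j
  asPerm-injective {i} {j} eq = faithful i j λ x →
    trans (sym (lookup∘tabulate (act i) x)) (trans (cong (λ σ → lookup σ x) eq) (lookup∘tabulate (act j) x))

  asPerm∈Sym : ∀ i → asPerm i ∈ Sym m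
  asPerm∈Sym i = ∈-filter⁺ isPerm? (∈-allVecs⁺ (allFin m) (asPerm i) (λ _ → ∈-allFin _))
    (lookup-injective⇒Unique (asPerm i) λ {x} {y} eq →
      injective i x y (trans (sym (lookup∘tabulate (act i) x)) (trans eq (lookup∘tabulate (act i) y))))

  asPerm-commute : ∀ i j → asPerm i ∘ₚ asPerm j ≡ asPerm j ∘ₚ asPerm i
  asPerm-commute i j = tabulate-cong λ x → begin
    lookup (asPerm i) (lookup (asPerm j) x) ≡⟨ lookup∘tabulate (act i) _ ⟩
    act i (lookup (asPerm j) x)             ≡⟨ cong (act i) (lookup∘tabulate (act j) x) ⟩
    act i (act j x)                         ≡⟨ commute i j x ⟩
    act j (act i x)                         ≡⟨ cong (act j) (lookup∘tabulate (act i) x) ⟨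
    act j (lookup (asPerm i) x)             ≡⟨ lookup∘tabulate (act j) _ ⟨
    lookup (asPerm j) (lookup (asPerm i) x) ∎
    where open ≡-Reasoning

  ^≤length-C : ∀ ℓ → c ^ ℓ ≤ length (C ℓ m)
  ^≤length-C ℓ = begin
    c ^ ℓ                       ≡⟨ cong (_^ ℓ) (List.length-tabulate asPerm) ⟨
    length members ^ ℓ          ≡⟨ length-allVecs ℓ members ⟨
    length (allVecs ℓ members)  ≤⟨ Unique-⊆⇒length≤ (allVecs-Unique ℓ (Unique.tabulate⁺ asPerm-injective)) tuples⊆C ⟩
    length (C ℓ m)              ∎
    where
    open ≤-Reasoning
    members : List (Map m)
    members = List.tabulate asPerm
    tuples⊆C : allVecs ℓ members ⊆ C ℓ m
    tuples⊆C {t} t∈ = ∈-filter⁺ commuting? (∈-allVecs⁺ (Sym m) t (λ i → member∈Sym (∈-allVecs⁻ members t∈ i)))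
                                           t-commuting
      where
      member∈Sym : ∀ {σ} → σ ∈ members → σ ∈ Sym m
      member∈Sym σ∈ with i , refl ← ∈-tabulate⁻ σ∈ = asPerm∈Sym i
      t-commuting : Commuting t
      t-commuting j k with i , eq ← ∈-tabulate⁻ (∈-allVecs⁻ members t∈ j)
                         | i′ , eq′ ← ∈-tabulate⁻ (∈-allVecs⁻ members t∈ k)
                         rewrite eq | eq′ = asPerm-commute i i′

p<q⇒p-q<0 : ∀ {p q : ℚ} → p ℚ.< q → p ℚ.- q ℚ.< 0ℚ
p<q⇒p-q<0 {p} {q} p<q = subst (p ℚ.- q ℚ.<_) (ℚ.+-inverseʳ q) (ℚ.+-monoˡ-< (ℚ.- q) p<q)

cross-multiplication-< : ∀ a b c d m n o p →
                         .{{_ : NonZero m}} .{{_ : NonZero n}} .{{_ : NonZero o}} .{{_ : NonZero p}} →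
                         a * b * (o * p) < c * d * (m * n) →
                         (+ a / m) ℚ.* (+ b / n) ℚ.< (+ c / o) ℚ.* (+ d / p)
cross-multiplication-< a b c d (suc m) (suc n) (suc o) (suc p) ineq =
  ℚ.toℚᵘ-cancel-< (ℚᵘ.<-respˡ-≃ (ℚᵘ.≃-sym (toℚᵘ-/*/ a b m n))
                  (ℚᵘ.<-respʳ-≃ (ℚᵘ.≃-sym (toℚᵘ-/*/ c d o p))
    (ℚᵘ.*<* (subst₂ ℤ._<_ (ℤ-*-* a b (suc o) (suc p)) (ℤ-*-* c d (suc m) (suc n)) (ℤ.+<+ ineq)))))
  where
  toℚᵘ-/*/ : ∀ a b m n → ℚ.toℚᵘ ((+ a / suc m) ℚ.* (+ b / suc n)) ℚᵘ.≃ ℚᵘ.mkℚᵘ (+ a) m ℚᵘ.* ℚᵘ.mkℚᵘ (+ b) n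
  toℚᵘ-/*/ a b m n = ℚᵘ.≃-trans (ℚ.toℚᵘ-homo-* (+ a / suc m) (+ b / suc n))
    (ℚᵘ.*-cong (ℚ.toℚᵘ-fromℚᵘ (ℚᵘ.mkℚᵘ (+ a) m)) (ℚ.toℚᵘ-fromℚᵘ (ℚᵘ.mkℚᵘ (+ b) n)))
  ℤ-*-* : ∀ a b c d → + (a * b * (c * d)) ≡ + a ℤ.* + b ℤ.* (+ c ℤ.* + d)
  ℤ-*-* a b c d = trans (ℤ.pos-* (a * b) (c * d)) (cong₂ ℤ._*_ (ℤ.pos-* a b) (ℤ.pos-* c d))

^-distribʳ-* : ∀ m n ℓ → (m * n) ^ ℓ ≡ m ^ ℓ * n ^ ℓ
^-distribʳ-* m n zero    = refl
^-distribʳ-* m n (suc ℓ) = trans (cong (m * n *_) (^-distribʳ-* m n ℓ)) (*-interchange m n (m ^ ℓ) (n ^ ℓ))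

16^ℓ*[16+2ℓ]≤16*18^ℓ : ∀ ℓ → 16 ^ ℓ * (16 + 2 * ℓ) ≤ 16 * 18 ^ ℓ
16^ℓ*[16+2ℓ]≤16*18^ℓ zero    = ≤-refl
16^ℓ*[16+2ℓ]≤16*18^ℓ (suc ℓ) = begin
  16 * 16 ^ ℓ * (16 + 2 * suc ℓ)  ≡⟨ expand (16 ^ ℓ) ℓ ⟩
  16 ^ ℓ * (288 + 32 * ℓ)         ≤⟨ *-monoʳ-≤ (16 ^ ℓ) (+-monoʳ-≤ 288 (*-monoˡ-≤ ℓ (m≤m+n 32 4))) ⟩
  16 ^ ℓ * (288 + 36 * ℓ)         ≡⟨ factor (16 ^ ℓ) ℓ ⟩
  18 * (16 ^ ℓ * (16 + 2 * ℓ))    ≤⟨ *-monoʳ-≤ 18 (16^ℓ*[16+2ℓ]≤16*18^ℓ ℓ) ⟩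
  18 * (16 * 18 ^ ℓ)              ≡⟨ x*yz≡y*xz 18 16 (18 ^ ℓ) ⟩
  16 * (18 * 18 ^ ℓ)              ∎
  where
  open ≤-Reasoning
  expand : ∀ y l → 16 * y * (16 + 2 * suc l) ≡ y * (288 + 32 * l)
  expand = solve-∀
  factor : ∀ y l → y * (288 + 36 * l) ≡ 18 * (y * (16 + 2 * l))
  factor = solve-∀

*16^ℓ<18^ℓ : ∀ D ℓ → 8 * D ≤ ℓ → D * 16 ^ ℓ < 18 ^ ℓ
*16^ℓ<18^ℓ D ℓ 8D≤ℓ = *-cancelˡ-< 16 (D * 16 ^ ℓ) (18 ^ ℓ) (begin-strict
  16 * (D * 16 ^ ℓ)      ≡⟨ cong (16 *_) (*-comm D (16 ^ ℓ)) ⟩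
  16 * (16 ^ ℓ * D)      ≡⟨ x*yz≡y*xz 16 (16 ^ ℓ) D ⟩
  16 ^ ℓ * (16 * D)      <⟨ *-monoʳ-< (16 ^ ℓ) {{m^n≢0 16 ℓ}} 16D<16+2ℓ ⟩
  16 ^ ℓ * (16 + 2 * ℓ)  ≤⟨ 16^ℓ*[16+2ℓ]≤16*18^ℓ ℓ ⟩
  16 * 18 ^ ℓ            ∎)
  where
  open ≤-Reasoning
  16D<16+2ℓ : 16 * D < 16 + 2 * ℓ
  16D<16+2ℓ = begin-strict
    16 * D       ≡⟨ *-assoc 2 8 D ⟩
    2 * (8 * D)  ≤⟨ *-monoʳ-≤ 2 8D≤ℓ ⟩
    2 * ℓ        <⟨ m<n+m (2 * ℓ) {16} (s≤s z≤n) ⟩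
    16 + 2 * ℓ   ∎

^*^≡[*]^ : ∀ {p q r} ℓ → p * q ≡ r → p ^ ℓ * q ^ ℓ ≡ r ^ ℓ
^*^≡[*]^ {p} {q} ℓ pq≡r = trans (sym (^-distribʳ-* p q ℓ)) (cong (_^ ℓ) pq≡r)

square<product : ∀ {a b c K x ℓ s} .{{_ : NonZero x}} →
                 b ≤ K * (4 * x) ^ ℓ → (3 * x) ^ ℓ ≤ a → (2 * (3 * x)) ^ ℓ ≤ c → 8 * (K * K * s) ≤ ℓ →
                 b * b * s < a * c
square<product {a} {b} {c} {K} {x} {ℓ} {s} b≤ a≥ c≥ ℓ≥ = begin-strict
  b * b * s                                     ≤⟨ *-monoˡ-≤ s (*-mono-≤ b≤ b≤) ⟩
  K * (4 * x) ^ ℓ * (K * (4 * x) ^ ℓ) * s       ≡⟨ regroup K ((4 * x) ^ ℓ) s ⟩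
  K * K * s * ((4 * x) ^ ℓ * (4 * x) ^ ℓ)       ≡⟨ cong (K * K * s *_) 16^ℓx²ℓ ⟩
  K * K * s * (16 ^ ℓ * (x * x) ^ ℓ)            ≡⟨ *-assoc (K * K * s) (16 ^ ℓ) _ ⟨
  K * K * s * 16 ^ ℓ * (x * x) ^ ℓ              <⟨ *-monoˡ-< ((x * x) ^ ℓ) {{m^n≢0 (x * x) ℓ {{m*n≢0 x x}}}}
                                                              (*16^ℓ<18^ℓ (K * K * s) ℓ ℓ≥) ⟩
  18 ^ ℓ * (x * x) ^ ℓ                          ≡⟨ 18^ℓx²ℓ ⟨
  (3 * x) ^ ℓ * (2 * (3 * x)) ^ ℓ               ≤⟨ *-mono-≤ a≥ c≥ ⟩
  a * c                                         ∎
  where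
  open ≤-Reasoning
  regroup : ∀ k y s → k * y * (k * y) * s ≡ k * k * s * (y * y)
  regroup = solve-∀
  16^ℓx²ℓ : (4 * x) ^ ℓ * (4 * x) ^ ℓ ≡ 16 ^ ℓ * (x * x) ^ ℓ
  16^ℓx²ℓ = trans (^*^≡[*]^ ℓ (four-squared x)) (^-distribʳ-* 16 (x * x) ℓ)
    where four-squared : ∀ x → 4 * x * (4 * x) ≡ 16 * (x * x)
          four-squared = solve-∀
  18^ℓx²ℓ : (3 * x) ^ ℓ * (2 * (3 * x)) ^ ℓ ≡ 18 ^ ℓ * (x * x) ^ ℓ
  18^ℓx²ℓ = trans (^*^≡[*]^ ℓ (three-times-six x)) (^-distribʳ-* 18 (x * x) ℓ)
    where three-times-six : ∀ x → 3 * x * (2 * (3 * x)) ≡ 18 * (x * x)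
          three-times-six = solve-∀

cross-factorials : ∀ m {u v} → u * (2 + m) < v → u * (m ! * (2 + m) !) < v * ((1 + m) ! * (1 + m) !)
cross-factorials m {u} {v} u[2+m]<v = begin-strict
  u * (m ! * (2 + m) !)                 ≡⟨ left u m (m !) ((1 + m) !) ⟩
  u * (2 + m) * (m ! * (1 + m) !)       <⟨ *-monoˡ-< (m ! * (1 + m) !)
                                             {{m*n≢0 (m !) ((1 + m) !) {{m !≢0}} {{(1 + m) !≢0}}}} u[2+m]<v ⟩
  v * (m ! * (1 + m) !)                 ≤⟨ *-monoˡ-≤ (m ! * (1 + m) !) (m≤m*n v (1 + m)) ⟩
  v * (1 + m) * (m ! * (1 + m) !)       ≡⟨ right v m (m !) ((1 + m) !) ⟩
  v * ((1 + m) ! * (1 + m) !)           ∎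
  where
  open ≤-Reasoning
  left : ∀ u m p q → u * (p * ((2 + m) * q)) ≡ u * (2 + m) * (p * q)
  left = solve-∀
  right : ∀ v m p q → v * (1 + m) * (p * q) ≡ v * ((1 + m) * p * q)
  right = solve-∀

N≡|C|/! : ∀ ℓ m .{{_ : NonZero m}} → N ℓ m ≡ (+ length (C ℓ m) / m !) {{m !≢0}}
N≡|C|/! ℓ (suc m) = refl

-- Kept for a variable m: checking Δ against a concrete size would make Agda evaluate C.
Δ<0-criterion : ∀ ℓ m .{{_ : NonZero m}} →
                length (C ℓ (1 + m)) * length (C ℓ (1 + m)) * (2 + m) < length (C ℓ m) * length (C ℓ (2 + m)) →
                Δ ℓ (1 + m) ℚ.< 0ℚ
Δ<0-criterion ℓ m ineq =
  subst (λ q → N ℓ (1 + m) ℚ.* N ℓ (1 + m) ℚ.- q ℚ.* N ℓ (2 + m) ℚ.< 0ℚ) (sym (N≡|C|/! ℓ m))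
    (p<q⇒p-q<0 (cross-multiplication-< b b a c ((1 + m) !) ((1 + m) !) (m !) ((2 + m) !)
                  {{(1 + m) !≢0}} {{(1 + m) !≢0}} {{m !≢0}} {{(2 + m) !≢0}} (cross-factorials m {b * b} {a * c} ineq)))
  where
  a b c : ℕ
  a = length (C ℓ m)
  b = length (C ℓ (1 + m))
  c = length (C ℓ (2 + m))

corollary1p5 : ∀ (N₀ : ℕ) → ∃ λ (L : ℕ) → ∃ λ (n : ℕ) →
    1 ≤ n × N₀ ≤ n × (∀ (ℓ : ℕ) → 1 ≤ ℓ → L ≤ ℓ → Δ ℓ n ℚ.< 0ℚ)
corollary1p5 N₀ = L , suc m , s≤s z≤n , N₀≤1+m , Δ<0
  where
  m K L : ℕ
  m = suc N₀ * 3
  K = length (subsequences (Sym (suc m)))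
  L = 8 * (K * K * (2 + m))
  N₀≤1+m : N₀ ≤ suc m
  N₀≤1+m = ≤-trans (n≤1+n N₀) (≤-trans (m≤m*n (suc N₀) 3) (n≤1+n m))
  Δ<0 : ∀ ℓ → 1 ≤ ℓ → L ≤ ℓ → Δ ℓ (suc m) ℚ.< 0ℚ
  Δ<0 ℓ _ L≤ℓ = Δ<0-criterion ℓ m (square<product {K = K} {s = 2 + m} {{m^n≢0 3 N₀}} upper lower lower′ L≤ℓ)
    where
    upper : length (C ℓ (1 + m)) ≤ K * (4 * 3 ^ N₀) ^ ℓ
    upper = subst (λ b → length (C ℓ (1 + m)) ≤ K * b ^ ℓ) (abelianBound-4+3k N₀) (length-C≤ ℓ (1 + m))
    lower : (3 ^ suc N₀) ^ ℓ ≤ length (C ℓ m)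
    lower = ^≤length-C (cyclic₃ ^⊗ suc N₀) ℓ
    lower′ : (2 * 3 ^ suc N₀) ^ ℓ ≤ length (C ℓ (2 + m))
    lower′ = ^≤length-C (cyclic₂ ⊗ cyclic₃ ^⊗ suc N₀) ℓ
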